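{- Let $G=(V,E)$ be a tree with $m=|E|$ edges. Then $T\chi^o_G(q)=(q+1)^m\chi_G$. In particular, $T\chi^o_G(q)$ is a symmetric function.
   Context: An orientation $\gamma$ of $G$ directs each edge; it is acyclic if there is no directed cycle. For a proper coloring $\kappa:V\to\mathbb{Z}_{>0}$ (adjacent vertices colored differently), $\mathrm{asc}^\gamma(\kappa)$ is the number of edges oriented $u\to v$ with $\kappa(u)<\kappa(v)$; $\chi^\gamma_G(x;q)=\sum_\kappa q^{\mathrm{asc}^\gamma(\kappa)}x^\kappa$ with $x^\kappa=\prod_j x_j^{\#\kappa^{ -1}(j)}$; $T\chi^o_G(q)=\sum_\gamma\chi^\gamma_G(x;q)$ over acyclic orientations. $\chi_G=\sum_\kappa x^\kappa$ (sum over proper colorings) is Stanley's chromatic symmetric function. -}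

module Defs where

open import Data.Nat using (ℕ; zero; suc; _+_; _≤_; _<ᵇ_)
open import Data.Fin using (Fin; toℕ; _≟_)
open import Data.Bool using (Bool; true; false; if_then_else_)
open import Data.Vec using (Vec; lookup; toList)
open import Data.List using (List; []; _∷_; length; map; allFin)
open import Data.Nat.ListAction using (sum)
open import Data.List.Relation.Unary.Unique.Propositional using (Unique)
open import Data.List.Relation.Unary.Linked using (Linked)
open import Data.List.Membership.Propositional using (_∈_)
open import Data.Product using (Σ; _×_; _,_; proj₁; proj₂; swap)
open import Data.Sum using (_⊎_)
open import Relation.Nullary using (¬_; does)
open import Relation.Binary.PropositionalEquality using (_≡_; _≢_)
open import Function.Bundles using (_⇔_)

-- Finite simple graphs with vertex set Fin n and m edges, given as a
-- vector of (unordered) edges {u,v}, each stored as a pair (u , v).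

Edges : ℕ → ℕ → Set
Edges n m = Vec (Fin n × Fin n) m

module _ {n m : ℕ} (E : Edges n m) where

  Adj : Fin n → Fin n → Set
  Adj u v = Σ (Fin m) λ i → (lookup E i ≡ (u , v)) ⊎ (lookup E i ≡ (v , u))

  Loopless : Set
  Loopless = ∀ i → proj₁ (lookup E i) ≢ proj₂ (lookup E i)

  NoMultiEdges : Set
  NoMultiEdges = ∀ i j → i ≢ j →
    ¬ ((lookup E i ≡ lookup E j) ⊎ (lookup E i ≡ swap (lookup E j)))

  SimpleGraph : Set
  SimpleGraph = Loopless × NoMultiEdges

  data Walk : Fin n → Fin n → Set where
    here : ∀ {u} → Walk u u
    step : ∀ {u w v} → Adj u w → Walk w v → Walk u v

  Connected : Set
  Connected = ∀ u v → Walk u v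

lastOf : {A : Set} → A → List A → A
lastOf a [] = a
lastOf a (x ∷ xs) = lastOf x xs

module _ {n m : ℕ} (E : Edges n m) where

  HasCycle : Set
  HasCycle = Σ (Fin n) λ v0 → Σ (List (Fin n)) λ rest →
    (2 ≤ length rest) × Unique (v0 ∷ rest) ×
    Linked (Adj E) (v0 ∷ rest) × Adj E (lastOf v0 rest) v0

  IsTree : Set
  IsTree = SimpleGraph E × Connected E × ¬ HasCycle

-- Orientations: γ i = true orients edge i = (u , v) as u → v,
-- γ i = false orients it as v → u.  Every orientation arises exactly once.

Orientation : ℕ → Set
Orientation m = Vec Bool m

module _ {n m : ℕ} (E : Edges n m) where

  arc : Orientation m → Fin m → Fin n × Fin n
  arc γ i = if lookup γ i then lookup E i else swap (lookup E i)

  Arc : Orientation m → Fin n → Fin n → Set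
  Arc γ u v = Σ (Fin m) λ i → arc γ i ≡ (u , v)

  HasDirectedCycle : Orientation m → Set
  HasDirectedCycle γ = Σ (Fin n) λ v0 → Σ (List (Fin n)) λ rest →
    Unique (v0 ∷ rest) × Linked (Arc γ) (v0 ∷ rest) × Arc γ (lastOf v0 rest) v0

  Acyclic : Orientation m → Set
  Acyclic γ = ¬ HasDirectedCycle γ

-- Colorings with colors in {1,…,N}, the color j+1 being represented by
-- j : Fin N.  (A monomial x^c only involves finitely many variables, so
-- every coefficient of a series in x1, x2, … is reached this way.)

Coloring : ℕ → ℕ → Set
Coloring n N = Vec (Fin N) n

module _ {n m : ℕ} (E : Edges n m) where

  Proper : ∀ {N} → Coloring n N → Set
  Proper κ = ∀ i → lookup κ (proj₁ (lookup E i)) ≢ lookup κ (proj₂ (lookup E i))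

  asc : ∀ {N} → Orientation m → Coloring n N → ℕ
  asc γ κ = sum (map (λ i → if toℕ (lookup κ (proj₁ (arc E γ i)))
                               <ᵇ toℕ (lookup κ (proj₂ (arc E γ i)))
                            then 1 else 0) (allFin m))

-- number of vertices receiving color j, i.e. the exponent of x_j in x^κ
content : ∀ {n N} → Coloring n N → Fin N → ℕ
content κ j = sum (map (λ a → if does (a ≟ j) then 1 else 0) (toList κ))

Card : {A : Set} → (A → Set) → ℕ → Set
Card {A} P k = Σ (List A) λ L → Unique L × (∀ x → (x ∈ L) ⇔ P x) × (length L ≡ k)

module _ {n m : ℕ} (E : Edges n m) where

  -- coefficient of q^k x^c in Tχ^o_G(q) = Σ_{γ acyclic} Σ_{κ proper} q^{asc} x^κ
  -- equals a
  TχCoeffIs : (N : ℕ) → (Fin N → ℕ) → ℕ → ℕ → Set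
  TχCoeffIs N c k a = Card {Orientation m × Coloring n N}
    (λ p → Acyclic E (proj₁ p) × Proper E (proj₂ p) ×
           (∀ j → content (proj₂ p) j ≡ c j) × (asc E (proj₁ p) (proj₂ p) ≡ k)) a

  -- coefficient of x^c in Stanley's χ_G equals b
  χCoeffIs : (N : ℕ) → (Fin N → ℕ) → ℕ → Set
  χCoeffIs N c b = Card {Coloring n N}
    (λ κ → Proper E κ × (∀ j → content κ j ≡ c j)) b

module Submission where

-- Every orientation of a forest is acyclic: a directed cycle through one or two
-- vertices would be a loop or a double edge, and a longer one is a cycle of the
-- underlying graph.  So Tχ sums over all 2^m orientations.  For a proper coloring
-- κ each edge is an ascent in exactly one of its two orientations, hence exactly
-- m C k orientations have k ascents (Pascal's rule, peeling off one edge), and the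
-- coefficient of q^k x^c is m C k times that of χ_G.  Symmetry is then inherited
-- from χ_G, since permuting the colors permutes the proper colorings.

open import Defs
open import Data.Nat using (ℕ; zero; suc; _+_; _*_; _<ᵇ_; z≤n; s≤s)
open import Data.Nat.Properties using (_≟_; suc-injective; *-zeroʳ; *-suc; +-comm)
open import Data.Nat.Combinatorics using (_C_; nCk+nC[k+1]≡[n+1]C[k+1])
open import Data.Fin as Fin using (Fin; toℕ)
open import Data.Fin.Properties using (toℕ-injective; all?)
open import Data.Fin.Permutation
  using (Permutation′; _⟨$⟩ʳ_; _⟨$⟩ˡ_; inverseˡ; inverseʳ) renaming (flip to flipₚ)
open import Data.Bool using (Bool; true; false; not; if_then_else_)
open import Data.Vec as Vec using (Vec; []; _∷_; lookup)
open import Data.Vec.Properties using (∷-injective; lookup-map; map-∘; map-cong; map-id)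
open import Data.Nat.ListAction using (sum)
open import Data.List
  using (List; []; _∷_; length; map; filter; _++_; cartesianProductWith; allFin)
open import Data.List.Properties
  using (++-identityʳ; map-tabulate; length-++; length-map; filter-++; filter-none; filter-≐)
import Data.List.Relation.Unary.All as All
import Data.List.Relation.Unary.AllPairs as AllPairs
open import Data.List.Relation.Unary.Linked as Linked using ([-]; _∷_)
open import Data.List.Relation.Unary.Any using (here; there)
open import Data.List.Relation.Unary.Unique.Propositional using (Unique)
import Data.List.Relation.Unary.Unique.Propositional.Properties as Unique
open import Data.List.Membership.Propositional using (_∈_)
open import Data.List.Membership.Propositional.Properties
  using (∈-filter⁺; ∈-filter⁻; ∈-allFin; ∈-cartesianProductWith⁺; ∈-map⁺; ∈-map⁻)
open import Data.List.Membership.Propositional.Properties.WithK using (unique∧set⇒bag)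
open import Data.List.Relation.Binary.BagAndSetEquality using (∼bag⇒↭)
open import Data.List.Relation.Binary.Permutation.Propositional.Properties using (↭-length)
open import Data.Product using (Σ; _×_; _,_; proj₁; proj₂; swap)
open import Data.Sum using (_⊎_; inj₁; inj₂; [_,_]′; reduce)
open import Data.Empty using (⊥-elim)
open import Function
  using (_∘_; id; flip; Injective; _↔_; Inverse; Injection; mk↔ₛ′; _⇔_; mk⇔; Equivalence)
import Function.Properties.Equivalence as ⇔
open import Function.Properties.Inverse using (↔⇒↣)
open import Level using (0ℓ)
open import Relation.Nullary using (¬_; Dec; yes; no; does; ¬?; _×-dec_)
open import Relation.Nullary.Decidable using (does-⇔)
open import Relation.Unary using (Pred; Decidable)
open import Relation.Binary.PropositionalEquality
  using (_≡_; _≢_; _≗_; refl; sym; trans; cong; cong₂; subst; module ≡-Reasoning)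

open ≡-Reasoning

module _ {A B : Set} {P : Pred B 0ℓ} (P? : Decidable P) where

  length-filter-map : ∀ (f : A → B) xs →
    length (filter P? (map f xs)) ≡ length (filter (P? ∘ f) xs)
  length-filter-map f [] = refl
  length-filter-map f (x ∷ xs) with does (P? (f x))
  ... | true  = cong suc (length-filter-map f xs)
  ... | false = length-filter-map f xs

module _ {A : Set} {P : Pred A 0ℓ} (P? : Decidable P) where

  length-filter-++ : ∀ xs ys →
    length (filter P? (xs ++ ys)) ≡ length (filter P? xs) + length (filter P? ys)
  length-filter-++ xs ys = trans (cong length (filter-++ P? xs ys)) (length-++ (filter P? xs))

module _ {A B : Set} {Q : Pred A 0ℓ} {R : Pred (B × A) 0ℓ}
         (Q? : Decidable Q) (R? : Decidable R) where

  length-filter-fibred : ∀ {M} (xs : List A) (ys : List B) →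
    (∀ {a} → Q a → length (filter (λ b → R? (b , a)) ys) ≡ M) →
    (∀ {a b} → R (b , a) → Q a) →
    length (filter R? (cartesianProductWith (flip _,_) xs ys)) ≡ M * length (filter Q? xs)
  length-filter-fibred {M} [] ys fibre base = sym (*-zeroʳ M)
  length-filter-fibred {M} (a ∷ xs) ys fibre base = begin
    length (filter R? (map (flip _,_ a) ys ++ cartesianProductWith (flip _,_) xs ys))
      ≡⟨ length-filter-++ R? (map (flip _,_ a) ys) _ ⟩
    length (filter R? (map (flip _,_ a) ys)) +
    length (filter R? (cartesianProductWith (flip _,_) xs ys))
      ≡⟨ cong₂ _+_ (length-filter-map R? (flip _,_ a) ys) (length-filter-fibred xs ys fibre base) ⟩
    length (filter (λ b → R? (b , a)) ys) + M * length (filter Q? xs)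
      ≡⟨ cons-case ⟩
    M * length (filter Q? (a ∷ xs)) ∎
    where
    cons-case : length (filter (λ b → R? (b , a)) ys) + M * length (filter Q? xs)
              ≡ M * length (filter Q? (a ∷ xs))
    cons-case with Q? a
    ... | yes qa = trans (cong (_+ _) (fibre qa)) (sym (*-suc M _))
    ... | no ¬qa = cong (λ l → length l + _) empty-fibre
      where
      empty-fibre : filter (λ b → R? (b , a)) ys ≡ []
      empty-fibre = filter-none (λ b → R? (b , a)) (All.universal (λ _ → ¬qa ∘ base) ys)

module _ {A : Set} {P : A → Set} where

  Card-filter : (P? : Decidable P) {xs : List A} → Unique xs → (∀ x → x ∈ xs) →
    Card P (length (filter P? xs))
  Card-filter P? {xs} xs! xs-complete =
    filter P? xs , Unique.filter⁺ P? xs! ,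
    (λ x → mk⇔ (proj₂ ∘ ∈-filter⁻ P? {xs = xs}) (∈-filter⁺ P? (xs-complete x))) , refl

  Card-cong : {Q : A → Set} {k : ℕ} → (∀ x → P x ⇔ Q x) → Card P k → Card Q k
  Card-cong P⇔Q (L , L! , L⇔P , |L|) = L , L! , (λ x → ⇔.trans (L⇔P x) (P⇔Q x)) , |L|

  Card-unique : {a b : ℕ} → Card P a → Card P b → a ≡ b
  Card-unique (L , L! , L⇔P , refl) (K , K! , K⇔P , refl) =
    ↭-length (∼bag⇒↭ (unique∧set⇒bag L! K! (⇔.trans (L⇔P _) (⇔.sym (K⇔P _)))))

  Card-map : {B : Set} {Q : B → Set} {k : ℕ} (f : A ↔ B) →
    (∀ x → P x ⇔ Q (Inverse.to f x)) → Card P k → Card Q k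
  Card-map {Q = Q} f P⇔Q (L , L! , L⇔P , |L|) =
    map to L , Unique.map⁺ (Injection.injective (↔⇒↣ f)) L! , (λ y → mk⇔ (∈⇒Q y) (Q⇒∈ y)) ,
    trans (length-map to L) |L|
    where
    open Inverse f using (to; from; strictlyInverseˡ)
    ∈⇒Q : ∀ y → y ∈ map to L → Q y
    ∈⇒Q y y∈ with ∈-map⁻ to y∈
    ... | x , x∈L , refl = Equivalence.to (P⇔Q x) (Equivalence.to (L⇔P x) x∈L)
    Q⇒∈ : ∀ y → Q y → y ∈ map to L
    Q⇒∈ y qy = subst (_∈ map to L) (strictlyInverseˡ y)
      (∈-map⁺ to (Equivalence.from (L⇔P (from y))
        (Equivalence.from (P⇔Q (from y)) (subst Q (sym (strictlyInverseˡ y)) qy))))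

module _ {A : Set} where

  vecs : List A → ∀ n → List (Vec A n)
  vecs xs zero    = [] ∷ []
  vecs xs (suc n) = cartesianProductWith _∷_ xs (vecs xs n)

  vecs-unique : ∀ {xs} n → Unique xs → Unique (vecs xs n)
  vecs-unique zero    xs! = All.[] AllPairs.∷ AllPairs.[]
  vecs-unique (suc n) xs! = Unique.cartesianProductWith⁺ _∷_ ∷-injective xs! (vecs-unique n xs!)

  ∈-vecs : ∀ {xs} → (∀ x → x ∈ xs) → ∀ {n} (v : Vec A n) → v ∈ vecs xs n
  ∈-vecs xs-complete []      = here refl
  ∈-vecs xs-complete (x ∷ v) = ∈-cartesianProductWith⁺ _∷_ (xs-complete x) (∈-vecs xs-complete v)

orientations : ∀ m → List (Orientation m)
orientations = vecs (true ∷ false ∷ [])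

orientations-unique : ∀ m → Unique (orientations m)
orientations-unique m = vecs-unique m (((λ ()) All.∷ All.[]) AllPairs.∷ (All.[] AllPairs.∷ AllPairs.[]))

∈-orientations : ∀ {m} (γ : Orientation m) → γ ∈ orientations m
∈-orientations = ∈-vecs λ { true → here refl ; false → there (here refl) }

colorings : ∀ n N → List (Coloring n N)
colorings n N = vecs (allFin N) n

colorings-unique : ∀ n N → Unique (colorings n N)
colorings-unique n N = vecs-unique n (Unique.allFin⁺ N)

∈-colorings : ∀ {n N} (κ : Coloring n N) → κ ∈ colorings n N
∈-colorings = ∈-vecs ∈-allFin

#[_≡_] : ∀ {m} → (Orientation m → ℕ) → ℕ → ℕ
#[_≡_] {m} w k = length (filter (λ γ → w γ ≟ k) (orientations m))

module _ {m : ℕ} where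

  #-cong : ∀ {w w′ : Orientation m → ℕ} {k} → w ≗ w′ → #[ w ≡ k ] ≡ #[ w′ ≡ k ]
  #-cong {w} {w′} {k} w≗w′ = cong length
    (filter-≐ (λ γ → w γ ≟ k) (λ γ → w′ γ ≟ k)
      ((λ {γ} → trans (sym (w≗w′ γ))) , (λ {γ} → trans (w≗w′ γ))) (orientations m))

  #-suc : ∀ {w : Orientation m → ℕ} {k} → #[ suc ∘ w ≡ suc k ] ≡ #[ w ≡ k ]
  #-suc {w} {k} = cong length
    (filter-≐ (λ γ → suc (w γ) ≟ suc k) (λ γ → w γ ≟ k) (suc-injective , cong suc)
      (orientations m))

  #-suc-zero : ∀ {w : Orientation m → ℕ} → #[ suc ∘ w ≡ 0 ] ≡ 0
  #-suc-zero {w} = cong length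
    (filter-none (λ γ → suc (w γ) ≟ 0) (All.universal (λ _ ()) (orientations m)))

  #-∷ : ∀ {w : Orientation (suc m) → ℕ} {k} b →
    #[ w ≡ k ] ≡ #[ w ∘ (b ∷_) ≡ k ] + #[ w ∘ (not b ∷_) ≡ k ]
  #-∷ {w} {k} true = begin
    length (filter P? (map (true ∷_) γs ++ map (false ∷_) γs ++ []))
      ≡⟨ length-filter-++ P? (map (true ∷_) γs) _ ⟩
    length (filter P? (map (true ∷_) γs)) + length (filter P? (map (false ∷_) γs ++ []))
      ≡⟨ cong₂ _+_ (length-filter-map P? (true ∷_) γs)
                   (trans (cong (length ∘ filter P?) (++-identityʳ (map (false ∷_) γs)))
                          (length-filter-map P? (false ∷_) γs)) ⟩
    #[ w ∘ (true ∷_) ≡ k ] + #[ w ∘ (false ∷_) ≡ k ] ∎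
    where
    γs : List (Orientation m)
    γs = orientations m
    P? : Decidable (λ γ → w γ ≡ k)
    P? γ = w γ ≟ k
  #-∷ {w} {k} false = trans (#-∷ true) (+-comm #[ w ∘ (true ∷_) ≡ k ] _)

weight : ∀ {m} → (Fin m → Bool → ℕ) → Orientation m → ℕ
weight {m} F γ = sum (map (λ i → F i (lookup γ i)) (allFin m))

weight-∷ : ∀ {m} (F : Fin (suc m) → Bool → ℕ) b γ →
  weight F (b ∷ γ) ≡ F Fin.zero b + weight (F ∘ Fin.suc) γ
weight-∷ F b γ = cong (F Fin.zero b +_) (cong sum
  (trans (map-tabulate Fin.suc (λ i → F i (lookup (b ∷ γ) i)))
         (sym (map-tabulate id (λ i → F (Fin.suc i) (lookup γ i))))))

OneHot : (Bool → ℕ) → Set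
OneHot f = (f true ≡ 1 × f false ≡ 0) ⊎ (f true ≡ 0 × f false ≡ 1)

#weight-pascal : ∀ {m} (F : Fin (suc m) → Bool → ℕ) b →
  F Fin.zero b ≡ 1 → F Fin.zero (not b) ≡ 0 →
  (∀ k → #[ weight (F ∘ Fin.suc) ≡ k ] ≡ m C k) → ∀ k → #[ weight F ≡ k ] ≡ suc m C k
#weight-pascal {m} F b F₀b≡1 F₀¬b≡0 ih k = begin
  #[ weight F ≡ k ]                                        ≡⟨ #-∷ {w = weight F} b ⟩
  #[ weight F ∘ (b ∷_) ≡ k ] + #[ weight F ∘ (not b ∷_) ≡ k ]
    ≡⟨ cong₂ _+_ (#-cong (λ γ → trans (weight-∷ F b γ) (cong (_+ weight F′ γ) F₀b≡1)))
                 (#-cong (λ γ → trans (weight-∷ F (not b) γ) (cong (_+ weight F′ γ) F₀¬b≡0))) ⟩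
  #[ suc ∘ weight F′ ≡ k ] + #[ weight F′ ≡ k ]           ≡⟨ pascal k ⟩
  suc m C k ∎
  where
  F′ : Fin m → Bool → ℕ
  F′ = F ∘ Fin.suc
  pascal : ∀ k → #[ suc ∘ weight F′ ≡ k ] + #[ weight F′ ≡ k ] ≡ suc m C k
  pascal zero    = cong₂ _+_ (#-suc-zero {w = weight F′}) (ih 0)
  pascal (suc k) = trans (cong₂ _+_ (trans (#-suc {w = weight F′}) (ih k)) (ih (suc k)))
                         (nCk+nC[k+1]≡[n+1]C[k+1] m k)

#weight≡C : ∀ {m} (F : Fin m → Bool → ℕ) → (∀ i → OneHot (F i)) →
  ∀ k → #[ weight F ≡ k ] ≡ m C k
#weight≡C {zero}  F oneHot zero    = refl
#weight≡C {zero}  F oneHot (suc k) = refl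
#weight≡C {suc m} F oneHot =
  [ (λ (F₀t≡1 , F₀f≡0) → #weight-pascal F true  F₀t≡1 F₀f≡0 ih)
  , (λ (F₀t≡0 , F₀f≡1) → #weight-pascal F false F₀f≡1 F₀t≡0 ih)
  ]′ (oneHot Fin.zero)
  where
  ih : ∀ k → #[ weight (F ∘ Fin.suc) ≡ k ] ≡ m C k
  ih = #weight≡C (F ∘ Fin.suc) (oneHot ∘ Fin.suc)

<ᵇ-oneHot : ∀ {x y} → x ≢ y → OneHot (λ b → if (if b then x <ᵇ y else y <ᵇ x) then 1 else 0)
<ᵇ-oneHot {zero}  {zero}  x≢y = ⊥-elim (x≢y refl)
<ᵇ-oneHot {zero}  {suc y} x≢y = inj₁ (refl , refl)
<ᵇ-oneHot {suc x} {zero}  x≢y = inj₂ (refl , refl)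
<ᵇ-oneHot {suc x} {suc y} x≢y = <ᵇ-oneHot (x≢y ∘ cong suc)

same-unordered-pair : {A : Set} {p q : A × A} {u v : A} →
  (p ≡ (u , v) ⊎ p ≡ (v , u)) → (q ≡ (v , u) ⊎ q ≡ (u , v)) → p ≡ q ⊎ p ≡ swap q
same-unordered-pair (inj₁ refl) (inj₁ refl) = inj₂ refl
same-unordered-pair (inj₁ refl) (inj₂ refl) = inj₁ refl
same-unordered-pair (inj₂ refl) (inj₁ refl) = inj₁ refl
same-unordered-pair (inj₂ refl) (inj₂ refl) = inj₂ refl

module _ {N : ℕ} (π : Permutation′ N) where

  ⟨$⟩ˡ≡⇔≡⟨$⟩ʳ : ∀ {a j} → π ⟨$⟩ˡ a ≡ j ⇔ a ≡ π ⟨$⟩ʳ j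
  ⟨$⟩ˡ≡⇔≡⟨$⟩ʳ = mk⇔ (λ e → trans (sym (inverseʳ π)) (cong (π ⟨$⟩ʳ_) e))
                    (λ e → trans (cong (π ⟨$⟩ˡ_) e) (inverseˡ π))

  recoloring : ∀ {n} → Coloring n N ↔ Coloring n N
  recoloring = mk↔ₛ′ (Vec.map (π ⟨$⟩ˡ_)) (Vec.map (π ⟨$⟩ʳ_))
    (map-inverse (λ _ → inverseˡ π)) (map-inverse (λ _ → inverseʳ π))
    where
    map-inverse : ∀ {f g : Fin N → Fin N} {n} → (∀ a → f (g a) ≡ a) →
      ∀ (κ : Coloring n N) → Vec.map f (Vec.map g κ) ≡ κ
    map-inverse {f} {g} f∘g≗id κ = trans (sym (map-∘ f g κ)) (trans (map-cong f∘g≗id κ) (map-id κ))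

  content-recolor : ∀ {n} (κ : Coloring n N) j →
    content (Vec.map (π ⟨$⟩ˡ_) κ) j ≡ content κ (π ⟨$⟩ʳ j)
  content-recolor []      j = refl
  content-recolor (a ∷ κ) j = cong₂ _+_
    (cong (if_then 1 else 0)
      (does-⇔ ⟨$⟩ˡ≡⇔≡⟨$⟩ʳ (π ⟨$⟩ˡ a Fin.≟ j) (a Fin.≟ π ⟨$⟩ʳ j)))
    (content-recolor κ j)

module _ {n m : ℕ} (E : Edges n m) where

  arc⇒edge : ∀ γ i {u v} → arc E γ i ≡ (u , v) → lookup E i ≡ (u , v) ⊎ lookup E i ≡ (v , u)
  arc⇒edge γ i e with lookup γ i
  ... | true  = inj₁ e
  ... | false = inj₂ (cong swap e)

  Arc⇒Adj : ∀ γ {u v} → Arc E γ u v → Adj E u v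
  Arc⇒Adj γ (i , e) = i , arc⇒edge γ i e

  Loopless⇒¬Adj-refl : Loopless E → ∀ {v} → ¬ Adj E v v
  Loopless⇒¬Adj-refl loopless (i , e) =
    let Eᵢ≡vv = reduce e in loopless i (trans (cong proj₁ Eᵢ≡vv) (sym (cong proj₂ Eᵢ≡vv)))

  SimpleGraph⇒¬2-cycle : SimpleGraph E → ∀ {γ u v} → u ≢ v → Arc E γ u v → ¬ Arc E γ v u
  SimpleGraph⇒¬2-cycle (_ , noMultiEdges) {γ} u≢v (i , eᵢ) (j , eⱼ) with i Fin.≟ j
  ... | yes refl = u≢v (cong proj₁ (trans (sym eᵢ) eⱼ))
  ... | no i≢j   = noMultiEdges i j i≢j
    (same-unordered-pair (arc⇒edge γ i eᵢ) (arc⇒edge γ j eⱼ))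

  SimpleGraph∧¬HasCycle⇒Acyclic : SimpleGraph E → ¬ HasCycle E → ∀ γ → Acyclic E γ
  SimpleGraph∧¬HasCycle⇒Acyclic (loopless , _) _ γ (v , [] , _ , _ , v→v) =
    Loopless⇒¬Adj-refl loopless (Arc⇒Adj γ v→v)
  SimpleGraph∧¬HasCycle⇒Acyclic simple _ γ
    (v₀ , v₁ ∷ [] , v₀v₁! , v₀→v₁ ∷ [-] , v₁→v₀) =
    SimpleGraph⇒¬2-cycle simple {γ} (All.head (AllPairs.head v₀v₁!)) v₀→v₁ v₁→v₀
  SimpleGraph∧¬HasCycle⇒Acyclic _ ¬cycle γ (v₀ , rest@(_ ∷ _ ∷ _) , rest! , path , closing) =
    ¬cycle (v₀ , rest , s≤s (s≤s z≤n) , rest! , Linked.map (Arc⇒Adj γ) path , Arc⇒Adj γ closing)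

  ascent : ∀ {N} → Coloring n N → Fin n × Fin n → ℕ
  ascent κ e = if toℕ (lookup κ (proj₁ e)) <ᵇ toℕ (lookup κ (proj₂ e)) then 1 else 0

  edgeAscent : ∀ {N} → Coloring n N → Fin m → Bool → ℕ
  edgeAscent κ i b = ascent κ (if b then lookup E i else swap (lookup E i))

  -- asc E γ κ is definitionally weight (edgeAscent κ) γ.
  #asc≡C : ∀ {N} (κ : Coloring n N) → Proper E κ → ∀ k → #[ (λ γ → asc E γ κ) ≡ k ] ≡ m C k
  #asc≡C κ proper = #weight≡C (edgeAscent κ) (λ i → <ᵇ-oneHot (proper i ∘ toℕ-injective))

  proper? : ∀ {N} (κ : Coloring n N) → Dec (Proper E κ)
  proper? κ = all? (λ i → ¬? (lookup κ (proj₁ (lookup E i)) Fin.≟ lookup κ (proj₂ (lookup E i))))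

  module _ {N : ℕ} (c : Fin N → ℕ) where

    HasContent : Coloring n N → Set
    HasContent κ = ∀ j → content κ j ≡ c j

    hasContent? : ∀ κ → Dec (HasContent κ)
    hasContent? κ = all? (λ j → content κ j ≟ c j)

    proper×hasContent? : ∀ κ → Dec (Proper E κ × HasContent κ)
    proper×hasContent? κ = proper? κ ×-dec hasContent? κ

    #proper : ℕ
    #proper = length (filter proper×hasContent? (colorings n N))

    χCoeff-#proper : χCoeffIs E N c #proper
    χCoeff-#proper = Card-filter proper×hasContent? (colorings-unique n N) ∈-colorings

    TχCoeff-#proper : (∀ γ → Acyclic E γ) → ∀ k → TχCoeffIs E N c k ((m C k) * #proper)
    TχCoeff-#proper acyclic k =
      Card-cong (λ (γ , _) → mk⇔ (acyclic γ ,_) proj₂)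
        (subst (Card _)
          (length-filter-fibred proper×hasContent? Tχ? (colorings n N) (orientations m)
            (λ {κ} → fibre κ) (λ (proper , hasContent , _) → proper , hasContent))
          (Card-filter Tχ? pairs-unique pairs-complete))
      where
      Tχ? : ∀ p → Dec (Proper E (proj₂ p) × HasContent (proj₂ p) × asc E (proj₁ p) (proj₂ p) ≡ k)
      Tχ? (γ , κ) = proper? κ ×-dec (hasContent? κ ×-dec (asc E γ κ ≟ k))
      fibre : ∀ κ → Proper E κ × HasContent κ →
        length (filter (λ γ → Tχ? (γ , κ)) (orientations m)) ≡ m C k
      fibre κ (proper , hasContent) = trans
        (cong length (filter-≐ (λ γ → Tχ? (γ , κ)) (λ γ → asc E γ κ ≟ k)
          (proj₂ ∘ proj₂ , (λ asc≡k → proper , hasContent , asc≡k)) (orientations m)))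
        (#asc≡C κ proper k)
      pairs-unique : Unique (cartesianProductWith (flip _,_) (colorings n N) (orientations m))
      pairs-unique = Unique.cartesianProductWith⁺ (flip _,_) (λ { refl → refl , refl })
        (colorings-unique n N) (orientations-unique m)
      pairs-complete : ∀ p → p ∈ cartesianProductWith (flip _,_) (colorings n N) (orientations m)
      pairs-complete (γ , κ) = ∈-cartesianProductWith⁺ (flip _,_) (∈-colorings κ) (∈-orientations γ)

  Proper-map : ∀ {N N′} {f : Fin N → Fin N′} → Injective _≡_ _≡_ f →
    ∀ (κ : Coloring n N) → Proper E κ → Proper E (Vec.map f κ)
  Proper-map {f = f} f-injective κ proper i eq =
    proper i (f-injective (trans (sym (lookup-map _ f κ)) (trans eq (lookup-map _ f κ))))

  Proper-map⁻ : ∀ {N N′} (f : Fin N → Fin N′) (κ : Coloring n N) →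
    Proper E (Vec.map f κ) → Proper E κ
  Proper-map⁻ f κ proper i eq =
    proper i (trans (lookup-map _ f κ) (trans (cong f eq) (sym (lookup-map _ f κ))))

  χCoeff-permute : ∀ {N c b} (π : Permutation′ N) →
    χCoeffIs E N c b → χCoeffIs E N (c ∘ (π ⟨$⟩ʳ_)) b
  χCoeff-permute {N} {c} π = Card-map (recoloring π) λ κ → mk⇔
    (λ (proper , hasContent) → Proper-map (Injection.injective (↔⇒↣ (flipₚ π))) κ proper ,
                               λ j → trans (content-recolor π κ j) (hasContent _))
    (λ (proper , hasContent) → Proper-map⁻ (π ⟨$⟩ˡ_) κ proper , λ j → begin
      content κ j                                    ≡⟨ cong (content κ) (sym (inverseʳ π)) ⟩
      content κ (π ⟨$⟩ʳ (π ⟨$⟩ˡ j))                  ≡⟨ sym (content-recolor π κ (π ⟨$⟩ˡ j)) ⟩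
      content (Vec.map (π ⟨$⟩ˡ_) κ) (π ⟨$⟩ˡ j)       ≡⟨ hasContent (π ⟨$⟩ˡ j) ⟩
      c (π ⟨$⟩ʳ (π ⟨$⟩ˡ j))                          ≡⟨ cong c (inverseʳ π) ⟩
      c j                                            ∎)

  module _ (acyclic : ∀ γ → Acyclic E γ) where

    χCoeff⇒TχCoeff : ∀ {N c b} → χCoeffIs E N c b → ∀ k → TχCoeffIs E N c k ((m C k) * b)
    χCoeff⇒TχCoeff {N} {c} χb k =
      subst (λ b → TχCoeffIs E N c k ((m C k) * b))
        (Card-unique (χCoeff-#proper c) χb) (TχCoeff-#proper c acyclic k)

    TχCoeff-permute : ∀ {N c k a} (π : Permutation′ N) →
      TχCoeffIs E N c k a → TχCoeffIs E N (c ∘ (π ⟨$⟩ʳ_)) k a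
    TχCoeff-permute {N} {c} {k} π Tχa = subst (TχCoeffIs E N (c ∘ (π ⟨$⟩ʳ_)) k)
      (Card-unique (χCoeff⇒TχCoeff (χCoeff-#proper c) k) Tχa)
      (χCoeff⇒TχCoeff (χCoeff-permute π (χCoeff-#proper c)) k)

theorem3p13 : {n m : ℕ} (E : Edges n m) → IsTree E →
    ((N : ℕ) (c : Fin N → ℕ) (k : ℕ) →
      Σ ℕ (λ b → χCoeffIs E N c b × TχCoeffIs E N c k ((m C k) * b)))
    × ((N : ℕ) (c : Fin N → ℕ) (k a : ℕ) (σ : Permutation′ N) →
      TχCoeffIs E N c k a → TχCoeffIs E N (c ∘ (σ ⟨$⟩ʳ_)) k a)
theorem3p13 E (simple , _ , ¬cycle) =
  (λ N c k → #proper E c , χCoeff-#proper E c , χCoeff⇒TχCoeff E acyclic (χCoeff-#proper E c) k) ,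
  (λ N c k a → TχCoeff-permute E acyclic)
  where
  acyclic : ∀ γ → Acyclic E γ
  acyclic = SimpleGraph∧¬HasCycle⇒Acyclic E simple ¬cycle
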